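{- If $P$ is a polyomino of minimum size among polyominoes which contain $27$ instances of the L tromino, then $34\le |P|\le 35$.
   Context: Cells are the unit squares of the square lattice, indexed by integer coordinates $(x,y)$. A polyomino is a finite nonempty edge-connected set of cells; its size $|P|$ is its number of cells. The L tromino is $\{(0,0),(1,0),(0,1)\}$ (only this orientation); an instance is a translate of it, and an instance in $P$ is one contained in $P$. "Contains $27$ instances" means contains at least $27$ distinct instances. -}

module Defs where

open import Data.Integer using (ℤ; _+_; +_)
open import Data.Nat using (ℕ; _≥_)
open import Data.Product using (_×_; _,_; Σ)
open import Data.Sum using (_⊎_)
open import Data.List using (List; []; _∷_; length)
open import Data.List.Membership.Propositional using (_∈_)
open import Data.List.Relation.Unary.All using (All)
open import Data.List.Relation.Unary.Unique.Propositional using (Unique)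
open import Relation.Binary.PropositionalEquality using (_≡_; _≢_)

Cell : Set
Cell = ℤ × ℤ

Adj : Cell → Cell → Set
Adj (x , y) (x' , y') =
  ((x' ≡ x + + 1) × (y' ≡ y)) ⊎
  ((x ≡ x' + + 1) × (y' ≡ y)) ⊎
  ((x' ≡ x) × (y' ≡ y + + 1)) ⊎
  ((x' ≡ x) × (y ≡ y' + + 1))

data Reach (S : List Cell) (a : Cell) : Cell → Set where
  here : a ∈ S → Reach S a a
  step : ∀ {b c} → Reach S a b → c ∈ S → Adj b c → Reach S a c

EdgeConnected : List Cell → Set
EdgeConnected S = ∀ {a b} → a ∈ S → b ∈ S → Reach S a b

record Polyomino : Set where
  field
    cells     : List Cell
    distinct  : Unique cells
    nonempty  : cells ≢ []
    connected : EdgeConnected cells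

open Polyomino public

size : Polyomino → ℕ
size P = length (cells P)

LInstance : Cell → List Cell
LInstance (x , y) = (x , y) ∷ (x + + 1 , y) ∷ (x , y + + 1) ∷ []

InstanceIn : Polyomino → Cell → Set
InstanceIn P t = All (λ c → c ∈ cells P) (LInstance t)

-- P contains at least k distinct instances of the L tromino
-- (distinct translates = distinct translation vectors).
ContainsInstances : ℕ → Polyomino → Set
ContainsInstances k P =
  Σ (List Cell) λ ts → Unique ts × length ts ≥ k × All (InstanceIn P) ts

MinimalFor : ℕ → Polyomino → Set
MinimalFor k P =
  ContainsInstances k P × (∀ (Q : Polyomino) → ContainsInstances k Q → size P Data.Nat.≤ size Q)

-- Let K be the set of corners of the L instances in P. For each row of K, the
-- cell just right of its rightmost corner lies in P but not in K, and so does
-- the cell above a topmost corner, which lies in no row of K. Hence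
-- |P| ≥ |K| + r + 1 for r the number of rows of K, and likewise with the
-- number c of columns. Since |K| ≤ c r, 27 corners force r ≥ 6 or c ≥ 6, so
-- |P| ≥ 34. Conversely the band of cells
-- (x , y) ∈ ℕ² with 1 ≤ x + y ≤ 7 is a polyomino of 35 cells with 27 instances.

module Submission where

open import Defs
open import Data.Nat using (_≤_)
open import Data.Product using (_×_)

open import Data.Nat.Base using (ℕ; suc; z≤n; s≤s; s≤s⁻¹; _+_; _*_; _∸_; _<_)
import Data.Nat.Properties as ℕ
open import Data.Nat.Properties using (_≤?_; _<?_)
open import Data.Integer.Base as ℤ using (ℤ; +_; ∣_∣)
import Data.Integer.Properties as ℤ
open import Data.Product.Base using (∃; _,_; proj₁; proj₂; swap)
open import Data.Product.Properties using (≡-dec)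
open import Data.Sum.Base using (_⊎_; inj₁; inj₂)
open import Data.Empty using (⊥-elim)
open import Function.Base using (_∘_; id)
open import Data.List.Base
  using (List; []; _∷_; _++_; length; map; filter; deduplicate; cartesianProduct; concatMap; upTo; applyUpTo)
open import Data.List.Properties using (length-++; length-map; length-removeAt′)
open import Data.List.Relation.Unary.Any using (Any; here; there; index; _─_; any?)
open import Data.List.Relation.Unary.All as All using (All; []; _∷_)
open import Data.List.Relation.Unary.All.Properties as All using (all-filter)
open import Data.List.Relation.Unary.AllPairs using (_∷_)
open import Data.List.Membership.Propositional using (_∈_; _∉_; find)
open import Data.List.Membership.Propositional.Properties
  using (∈-map⁺; ∈-map⁻; ∈-++⁻; ∈-filter⁺; ∈-deduplicate⁺; ∈-deduplicate⁻; ∈-cartesianProduct⁺)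
open import Data.List.Relation.Binary.Subset.Propositional using (_⊆_)
open import Data.List.Relation.Binary.Subset.Propositional.Properties using (filter-⊆)
open import Data.List.Relation.Unary.Unique.Propositional using (Unique)
import Data.List.Relation.Unary.Unique.Propositional.Properties as Unique
open import Data.List.Relation.Unary.Unique.DecPropositional.Properties using (deduplicate-!)
open import Data.List.Extrema ℤ.≤-totalOrder using (argmax; argmax-all; f[xs]≤f[argmax])
open import Relation.Nullary using (¬_; Dec; yes; no)
open import Relation.Nullary.Decidable using (from-yes; _×-dec_; _⊎-dec_)
open import Relation.Binary.PropositionalEquality
  using (_≡_; _≢_; refl; sym; trans; cong; cong₂; subst; subst₂)

module _ {A : Set} where

  ∈-─⁺ : ∀ {x y : A} {ys} (x∈ys : x ∈ ys) → y ∈ ys → y ≢ x → y ∈ (ys ─ x∈ys)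
  ∈-─⁺ (here refl)  (here refl)  y≢x = ⊥-elim (y≢x refl)
  ∈-─⁺ (here refl)  (there y∈ys) _   = y∈ys
  ∈-─⁺ (there _)    (here refl)  _   = here refl
  ∈-─⁺ (there x∈ys) (there y∈ys) y≢x = there (∈-─⁺ x∈ys y∈ys y≢x)

  unique⊆⇒length≤ : ∀ {xs ys : List A} → Unique xs → xs ⊆ ys → length xs ≤ length ys
  unique⊆⇒length≤ {[]}          _            _     = z≤n
  unique⊆⇒length≤ {x ∷ xs} {ys} (x∉xs ∷ uxs) xs⊆ys = begin
    suc (length xs)          ≤⟨ s≤s (unique⊆⇒length≤ uxs xs⊆ys─x) ⟩
    suc (length (ys ─ x∈ys)) ≡⟨ length-removeAt′ ys (index x∈ys) ⟨
    length ys                ∎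
    where
    open ℕ.≤-Reasoning
    x∈ys = xs⊆ys (here refl)
    xs⊆ys─x : xs ⊆ (ys ─ x∈ys)
    xs⊆ys─x y∈xs = ∈-─⁺ x∈ys (xs⊆ys (there y∈xs)) (All.lookup x∉xs y∈xs ∘ sym)

module _ {A B : Set} where

  length-cartesianProduct : (xs : List A) (ys : List B) →
                            length (cartesianProduct xs ys) ≡ length xs * length ys
  length-cartesianProduct []       ys = refl
  length-cartesianProduct (x ∷ xs) ys = trans (length-++ (map (x ,_) ys))
    (cong₂ _+_ (length-map (x ,_) ys) (length-cartesianProduct xs ys))

right up : Cell → Cell
right (x , y) = (x ℤ.+ + 1 , y)
up    (x , y) = (x , y ℤ.+ + 1)

i+1≰i : ∀ i → ¬ (i ℤ.+ + 1 ℤ.≤ i)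
i+1≰i i i+1≤i = ℤ.i≮i (ℤ.suc[i]≤j⇒i<j (subst (ℤ._≤ i) (ℤ.+-comm i (+ 1)) i+1≤i))

_≟ᶜ_ : (c d : Cell) → Dec (c ≡ d)
_≟ᶜ_ = ≡-dec ℤ._≟_ ℤ._≟_

open import Data.List.Membership.DecPropositional _≟ᶜ_ using (_∈?_)
open import Data.List.Relation.Unary.Unique.DecPropositional _≟ᶜ_ using (unique?)

InstanceInCells : List Cell → Cell → Set
InstanceInCells S t = All (_∈ S) (LInstance t)

module _ {S : List Cell} {t : Cell} where

  corner∈ : InstanceInCells S t → t ∈ S
  corner∈ (t∈S ∷ _) = t∈S

  right∈ : InstanceInCells S t → right t ∈ S
  right∈ (_ ∷ r∈S ∷ _) = r∈S

  up∈ : InstanceInCells S t → up t ∈ S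
  up∈ (_ ∷ _ ∷ u∈S ∷ _) = u∈S

  swap-instance : InstanceInCells S t → InstanceInCells (map swap S) (swap t)
  swap-instance (t∈S ∷ r∈S ∷ u∈S ∷ []) = ∈-map⁺ swap t∈S ∷ ∈-map⁺ swap u∈S ∷ ∈-map⁺ swap r∈S ∷ []

adj-sym : ∀ {b c} → Adj b c → Adj c b
adj-sym (inj₁ (x′≡x+1 , y′≡y))               = inj₂ (inj₁ (x′≡x+1 , sym y′≡y))
adj-sym (inj₂ (inj₁ (x≡x′+1 , y′≡y)))        = inj₁ (x≡x′+1 , sym y′≡y)
adj-sym (inj₂ (inj₂ (inj₁ (x′≡x , y′≡y+1)))) = inj₂ (inj₂ (inj₂ (sym x′≡x , y′≡y+1)))
adj-sym (inj₂ (inj₂ (inj₂ (x′≡x , y≡y′+1)))) = inj₂ (inj₂ (inj₁ (sym x′≡x , y≡y′+1)))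

adj? : (b c : Cell) → Dec (Adj b c)
adj? (x , y) (x′ , y′) =
  ((x′ ℤ.≟ x ℤ.+ + 1) ×-dec (y′ ℤ.≟ y)) ⊎-dec
  ((x ℤ.≟ x′ ℤ.+ + 1) ×-dec (y′ ℤ.≟ y)) ⊎-dec
  ((x′ ℤ.≟ x) ×-dec (y′ ℤ.≟ y ℤ.+ + 1)) ⊎-dec
  ((x′ ℤ.≟ x) ×-dec (y ℤ.≟ y′ ℤ.+ + 1))

module _ {S : List Cell} where

  reach-trans : ∀ {a b c} → Reach S a b → Reach S b c → Reach S a c
  reach-trans a⇝b (here _)              = a⇝b
  reach-trans a⇝b (step b⇝c′ c∈S c′~c) = step (reach-trans a⇝b b⇝c′) c∈S c′~c

  reach-∈ : ∀ {a b} → Reach S a b → b ∈ S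
  reach-∈ (here b∈S)     = b∈S
  reach-∈ (step _ b∈S _) = b∈S

  reach-sym : ∀ {a b} → Reach S a b → Reach S b a
  reach-sym (here a∈S)             = here a∈S
  reach-sym (step a⇝b′ b∈S b′~b) =
    reach-trans (step (here b∈S) (reach-∈ a⇝b′) (adj-sym b′~b)) (reach-sym a⇝b′)

module Descent (S : List Cell) (root : Cell) (rank : Cell → ℕ) where

  Descends : Cell → Set
  Descends c = c ≡ root ⊎ Any (λ d → Adj d c × rank d < rank c) S

  descends? : (c : Cell) → Dec (Descends c)
  descends? c = (c ≟ᶜ root) ⊎-dec any? (λ d → adj? d c ×-dec (rank d <? rank c)) S

  module _ (root∈S : root ∈ S) (descent : All Descends S) where

    reach-from-root : ∀ n {c} → c ∈ S → rank c < n → Reach S root c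
    reach-from-root (suc n) c∈S rank<1+n with All.lookup descent c∈S
    ... | inj₁ refl = here root∈S
    ... | inj₂ lower with find lower
    ...   | d , d∈S , d~c , rank-d<rank-c =
      step (reach-from-root n d∈S (ℕ.<-≤-trans rank-d<rank-c (s≤s⁻¹ rank<1+n))) c∈S d~c

    descent⇒connected : EdgeConnected S
    descent⇒connected a∈S b∈S = reach-trans (reach-sym (from-root a∈S)) (from-root b∈S)
      where
      from-root : ∀ {c} → c ∈ S → Reach S root c
      from-root {c} c∈S = reach-from-root (suc (rank c)) c∈S ℕ.≤-refl

module Rows (K : List Cell) where

  rowOf : Cell → List Cell
  rowOf c = filter (λ d → proj₂ d ℤ.≟ proj₂ c) K

  rowEnd : Cell → Cell
  rowEnd c = argmax proj₁ c (rowOf c)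

  rowEnd-∈ : ∀ {c} → c ∈ K → rowEnd c ∈ K
  rowEnd-∈ c∈K = argmax-all proj₁ c∈K (All.tabulate (filter-⊆ _ K))

  rowEnd-row : ∀ c → proj₂ (rowEnd c) ≡ proj₂ c
  rowEnd-row c = argmax-all proj₁ {P = λ d → proj₂ d ≡ proj₂ c} refl (all-filter _ K)

  right-rowEnd-∉ : ∀ c → right (rowEnd c) ∉ K
  right-rowEnd-∉ c r∈K = i+1≰i (proj₁ (rowEnd c))
    (All.lookup (f[xs]≤f[argmax] {f = proj₁} c (rowOf c))
      (∈-filter⁺ (λ d → proj₂ d ℤ.≟ proj₂ c) r∈K (rowEnd-row c)))

  rowExits : List Cell
  rowExits = deduplicate _≟ᶜ_ (map (right ∘ rowEnd) K)

  ∈-rowExits⁻ : ∀ {e} → e ∈ rowExits → ∃ λ k → k ∈ K × e ≡ right (rowEnd k)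
  ∈-rowExits⁻ e∈ = ∈-map⁻ (right ∘ rowEnd) (∈-deduplicate⁻ _≟ᶜ_ _ e∈)

  row∈rowExits : ∀ {k} → k ∈ K → proj₂ k ∈ map proj₂ rowExits
  row∈rowExits {k} k∈K = subst (_∈ map proj₂ rowExits) (rowEnd-row k)
    (∈-map⁺ proj₂ (∈-deduplicate⁺ _≟ᶜ_ (∈-map⁺ (right ∘ rowEnd) k∈K)))

  rowExits-unique : Unique rowExits
  rowExits-unique = deduplicate-! _≟ᶜ_ (map (right ∘ rowEnd) K)

  rowExits-∉ : ∀ {e} → e ∈ rowExits → e ∉ K
  rowExits-∉ e∈ with ∈-rowExits⁻ e∈
  ... | k , _ , refl = right-rowEnd-∉ k

  rowExits-⊆ : ∀ {S} → All (InstanceInCells S) K → rowExits ⊆ S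
  rowExits-⊆ inst e∈ with ∈-rowExits⁻ e∈
  ... | k , k∈K , refl = right∈ (All.lookup inst (rowEnd-∈ k∈K))

  row-bound : ∀ {S k} → Unique K → All (InstanceInCells S) K → k ∈ K →
              length K + length rowExits < length S
  row-bound {S} {k} uK inst k∈K =
    subst (_≤ length S) (cong suc (length-++ K)) (unique⊆⇒length≤ unique ⊆S)
    where
    top = argmax proj₂ k K
    below-top : All (λ d → proj₂ d ℤ.≤ proj₂ top) K
    below-top = f[xs]≤f[argmax] k K
    not-above-top : ∀ {v} → v ∈ K ++ rowExits → proj₂ v ℤ.≤ proj₂ top
    not-above-top v∈ with ∈-++⁻ K v∈
    ... | inj₁ v∈K = All.lookup below-top v∈K
    ... | inj₂ v∈E with ∈-rowExits⁻ v∈E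
    ...   | k′ , k′∈K , refl = subst (ℤ._≤ proj₂ top) (sym (rowEnd-row k′)) (All.lookup below-top k′∈K)
    unique : Unique (up top ∷ K ++ rowExits)
    unique = All.tabulate (λ v∈ u≡v → i+1≰i (proj₂ top)
                             (subst (λ w → proj₂ w ℤ.≤ proj₂ top) (sym u≡v) (not-above-top v∈)))
           ∷ Unique.++⁺ uK rowExits-unique (λ (v∈K , v∈E) → rowExits-∉ v∈E v∈K)
    ⊆S : (up top ∷ K ++ rowExits) ⊆ S
    ⊆S (here refl) = up∈ (All.lookup inst (argmax-all proj₂ k∈K (All.tabulate id)))
    ⊆S (there v∈) with ∈-++⁻ K v∈
    ... | inj₁ v∈K = corner∈ (All.lookup inst v∈K)
    ... | inj₂ v∈E = rowExits-⊆ inst v∈E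

open Rows using (rowExits; row∈rowExits; row-bound)

corners≤columns*rows : ∀ {K} → Unique K →
                       length K ≤ length (rowExits (map swap K)) * length (rowExits K)
corners≤columns*rows {K} uK = begin
  length K                                             ≤⟨ unique⊆⇒length≤ uK column×row ⟩
  length (cartesianProduct columns rows)               ≡⟨ length-cartesianProduct columns rows ⟩
  length columns * length rows                         ≡⟨ cong₂ _*_ (length-map proj₂ (rowExits (map swap K)))
                                                                    (length-map proj₂ (rowExits K)) ⟩
  length (rowExits (map swap K)) * length (rowExits K) ∎
  where
  open ℕ.≤-Reasoning
  rows columns : List ℤ
  rows    = map proj₂ (rowExits K)
  columns = map proj₂ (rowExits (map swap K))
  column×row : K ⊆ cartesianProduct columns rows
  column×row k∈K = ∈-cartesianProduct⁺ (row∈rowExits (map swap K) (∈-map⁺ swap k∈K)) (row∈rowExits K k∈K)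

cells-lower-bound : ∀ {S K} m → Unique K → All (InstanceInCells S) K → m * m < length K →
                    suc m + length K < length S
cells-lower-bound {K = []} m _ _ ()
cells-lower-bound {S} {K@(_ ∷ _)} m uK inst m*m<|K| =
  by-cases (suc m ≤? length (rowExits K)) (suc m ≤? length (rowExits (map swap K)))
  where
  exits-bound : ∀ {e} → m < e → length K + e < length S → suc m + length K < length S
  exits-bound {e} m<e K+e<S = begin-strict
    suc m + length K ≤⟨ ℕ.+-monoˡ-≤ (length K) m<e ⟩
    e + length K     ≡⟨ ℕ.+-comm e (length K) ⟩
    length K + e     <⟨ K+e<S ⟩
    length S         ∎
    where open ℕ.≤-Reasoning
  column-bound : length K + length (rowExits (map swap K)) < length S
  column-bound = subst₂ (λ a b → a + length (rowExits (map swap K)) < b)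
                        (length-map swap K) (length-map swap S)
    (row-bound (map swap K) (Unique.map⁺ (cong swap) uK) (All.map⁺ (All.map swap-instance inst)) (here refl))
  by-cases : Dec (m < length (rowExits K)) → Dec (m < length (rowExits (map swap K))) →
             suc m + length K < length S
  by-cases (yes m<rows) _               = exits-bound m<rows (row-bound K uK inst (here refl))
  by-cases (no _)       (yes m<columns) = exits-bound m<columns column-bound
  by-cases (no m≮rows)  (no m≮columns)  = ⊥-elim (ℕ.<-irrefl refl (begin-strict
    length K                                             ≤⟨ corners≤columns*rows uK ⟩
    length (rowExits (map swap K)) * length (rowExits K) ≤⟨ ℕ.*-mono-≤ (ℕ.≮⇒≥ m≮columns) (ℕ.≮⇒≥ m≮rows) ⟩
    m * m                                                <⟨ m*m<|K| ⟩
    length K                                             ∎))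
    where open ℕ.≤-Reasoning

antidiagonal : ℕ → List Cell
antidiagonal s = map (λ x → (+ x , + (s ∸ x))) (upTo (suc s))

band : ℕ → List Cell
band n = concatMap antidiagonal (applyUpTo suc n)

band-polyomino : Polyomino
band-polyomino = record
  { cells     = band 7
  ; distinct  = from-yes (unique? (band 7))
  ; nonempty  = λ ()
  ; connected = descent⇒connected (from-yes (corner ∈? band 7)) (from-yes (All.all? descends? (band 7)))
  }
  where
  corner : Cell
  corner = (+ 0 , + 7)
  -- Every other cell of the band has a neighbour in the band nearer to corner
  -- in taxicab distance.
  open Descent (band 7) corner (λ (x , y) → ∣ x ∣ + ∣ y ℤ.- + 7 ∣)

band-instances : ContainsInstances 27 band-polyomino
band-instances = band 6 , from-yes (unique? (band 6)) , ℕ.≤-refl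
               , from-yes (All.all? (λ t → All.all? (_∈? band 7) (LInstance t)) (band 6))

theorem7p6 : (P : Polyomino) → MinimalFor 27 P → (34 ≤ size P) × (size P ≤ 35)
theorem7p6 P ((K , uK , 27≤|K| , inst) , minimal) = 34≤|P| , minimal band-polyomino band-instances
  where
  34≤|P| : 34 ≤ size P
  34≤|P| = ℕ.≤-trans (s≤s (ℕ.+-monoʳ-≤ 6 27≤|K|)) (cells-lower-bound 5 uK inst (ℕ.≤-trans (ℕ.n≤1+n 26) 27≤|K|))
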